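{- Let $A$ be a $p$-semisimple pseudo-BCI algebra and let $d$ be a type II symmetric derivation on $A$. Then for all $x,y\in A$: (1) $d(x\to y)=d(x)\to y$ and $d(x\rightsquigarrow y)=d(x)\rightsquigarrow y$; (2) $x\to d(x)=y\to d(y)$ and $x\rightsquigarrow d(x)=y\rightsquigarrow d(y)$; (3) $x\to d(x)=d(y)\to y$ and $x\rightsquigarrow d(x)=d(y)\rightsquigarrow y$.
   Context: A pseudo-BCI algebra is a structure $(A,\to,\rightsquigarrow,1)$ of type $(2,2,0)$ such that for all $x,y,z\in A$: $(x\to y)\rightsquigarrow[(y\to z)\rightsquigarrow(x\to z)]=1$; $(x\rightsquigarrow y)\to[(y\rightsquigarrow z)\to(x\rightsquigarrow z)]=1$; $1\to x=x$; $1\rightsquigarrow x=x$; and $x\to y=1$, $y\to x=1$ imply $x=y$. Write $x\le y$ iff $x\to y=1$. $A$ is $p$-semisimple if $x\le 1$ implies $x=1$. Put $x\Cup_1 y=(x\to y)\rightsquigarrow y$ and $x\Cup_2 y=(x\rightsquigarrow y)\to y$. A map $d:A\to A$ is a type II symmetric derivation if $d(x\to y)=(d(x)\to y)\Cup_2(d(y)\to x)$ and $d(x\rightsquigarrow y)=(d(x)\rightsquigarrow y)\Cup_1(d(y)\rightsquigarrow x)$ for all $x,y\in A$. -}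

module Defs where

open import Level using (Level; suc)
open import Relation.Binary.PropositionalEquality using (_≡_)
open import Data.Product using (_×_)

record PseudoBCI (a : Level) : Set (suc a) where
  infixr 5 _⇒_ _⇝_
  field
    Carrier : Set a
    _⇒_     : Carrier → Carrier → Carrier
    _⇝_     : Carrier → Carrier → Carrier
    𝟏       : Carrier
    ax1 : ∀ x y z → (x ⇒ y) ⇝ ((y ⇒ z) ⇝ (x ⇒ z)) ≡ 𝟏
    ax2 : ∀ x y z → (x ⇝ y) ⇒ ((y ⇝ z) ⇒ (x ⇝ z)) ≡ 𝟏
    ax3 : ∀ x → 𝟏 ⇒ x ≡ x
    ax4 : ∀ x → 𝟏 ⇝ x ≡ x
    ax5 : ∀ x y → x ⇒ y ≡ 𝟏 → y ⇒ x ≡ 𝟏 → x ≡ y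

  _≤_ : Carrier → Carrier → Set a
  x ≤ y = x ⇒ y ≡ 𝟏

  _⋓₁_ : Carrier → Carrier → Carrier
  x ⋓₁ y = (x ⇒ y) ⇝ y

  _⋓₂_ : Carrier → Carrier → Carrier
  x ⋓₂ y = (x ⇝ y) ⇒ y

open PseudoBCI public

IsPSemisimple : ∀ {a} → PseudoBCI a → Set a
IsPSemisimple A = ∀ x → _≤_ A x (𝟏 A) → x ≡ 𝟏 A

IsTypeIISymDerivation : ∀ {a} (A : PseudoBCI a) → (Carrier A → Carrier A) → Set a
IsTypeIISymDerivation A d =
  (∀ x y → d (_⇒_ A x y) ≡ _⋓₂_ A (_⇒_ A (d x) y) (_⇒_ A (d y) x))
  × (∀ x y → d (_⇝_ A x y) ≡ _⋓₁_ A (_⇝_ A (d x) y) (_⇝_ A (d y) x))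

-- In a p-semisimple pseudo-BCI algebra the inequality x ≤ y forces x = y,
-- so both joins collapse: x ⋓₁ y = x ⋓₂ y = x.  The defining equations of a
-- type II symmetric derivation then reduce to d (x → y) = d x → y, and taking
-- x = 1 shows that d is the translation z ↦ d 1 → z = d 1 ⇝ z.  Finally
-- d (x → d x) = d x → d x = 1 gives x → d x = d 1, and d y → y = (d 1 ⇝ y) → y
-- = d 1, and symmetrically for ⇝.
module Submission where

open import Defs using (PseudoBCI; IsPSemisimple; IsTypeIISymDerivation)
open PseudoBCI using (Carrier)
open import Level using (Level)
open import Data.Product using (_×_; _,_; proj₁; proj₂)
open import Relation.Binary.PropositionalEquality
  using (_≡_; sym; trans; cong; cong₂; module ≡-Reasoning)

module PseudoBCIProperties {a : Level} (A : PseudoBCI a) where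
  open PseudoBCI A hiding (Carrier)
  open ≡-Reasoning

  ⇒-refl : ∀ x → x ⇒ x ≡ 𝟏
  ⇒-refl x = begin
    x ⇒ x                            ≡⟨ sym (ax3 (x ⇒ x)) ⟩
    𝟏 ⇒ (x ⇒ x)                      ≡⟨ sym (cong₂ (λ u v → u ⇒ (v ⇒ v)) (ax4 𝟏) (ax4 x)) ⟩
    (𝟏 ⇝ 𝟏) ⇒ ((𝟏 ⇝ x) ⇒ (𝟏 ⇝ x))    ≡⟨ ax2 𝟏 𝟏 x ⟩
    𝟏                                ∎

  ⇝-refl : ∀ x → x ⇝ x ≡ 𝟏
  ⇝-refl x = begin
    x ⇝ x                            ≡⟨ sym (ax4 (x ⇝ x)) ⟩
    𝟏 ⇝ (x ⇝ x)                      ≡⟨ sym (cong₂ (λ u v → u ⇝ (v ⇝ v)) (ax3 𝟏) (ax3 x)) ⟩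
    (𝟏 ⇒ 𝟏) ⇝ ((𝟏 ⇒ x) ⇝ (𝟏 ⇒ x))    ≡⟨ ax1 𝟏 𝟏 x ⟩
    𝟏                                ∎

  x⇝x⋓₁y≡𝟏 : ∀ x y → x ⇝ (x ⋓₁ y) ≡ 𝟏
  x⇝x⋓₁y≡𝟏 x y = begin
    x ⇝ ((x ⇒ y) ⇝ y)                ≡⟨ sym (cong₂ (λ u v → u ⇝ ((x ⇒ y) ⇝ v)) (ax3 x) (ax3 y)) ⟩
    (𝟏 ⇒ x) ⇝ ((x ⇒ y) ⇝ (𝟏 ⇒ y))    ≡⟨ ax1 𝟏 x y ⟩
    𝟏                                ∎

  x⇒x⋓₂y≡𝟏 : ∀ x y → x ⇒ (x ⋓₂ y) ≡ 𝟏
  x⇒x⋓₂y≡𝟏 x y = begin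
    x ⇒ ((x ⇝ y) ⇒ y)                ≡⟨ sym (cong₂ (λ u v → u ⇒ ((x ⇝ y) ⇒ v)) (ax4 x) (ax4 y)) ⟩
    (𝟏 ⇝ x) ⇒ ((x ⇝ y) ⇒ (𝟏 ⇝ y))    ≡⟨ ax2 𝟏 x y ⟩
    𝟏                                ∎

  ⇝≡𝟏⇒⇒≡𝟏 : ∀ {x y} → x ⇝ y ≡ 𝟏 → x ⇒ y ≡ 𝟏
  ⇝≡𝟏⇒⇒≡𝟏 {x} {y} x⇝y≡𝟏 = begin
    x ⇒ y              ≡⟨ cong (x ⇒_) (sym (ax3 y)) ⟩
    x ⇒ (𝟏 ⇒ y)        ≡⟨ cong (λ u → x ⇒ (u ⇒ y)) (sym x⇝y≡𝟏) ⟩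
    x ⇒ (x ⋓₂ y)       ≡⟨ x⇒x⋓₂y≡𝟏 x y ⟩
    𝟏                  ∎

  ⇒≡𝟏⇒⇝≡𝟏 : ∀ {x y} → x ⇒ y ≡ 𝟏 → x ⇝ y ≡ 𝟏
  ⇒≡𝟏⇒⇝≡𝟏 {x} {y} x⇒y≡𝟏 = begin
    x ⇝ y              ≡⟨ cong (x ⇝_) (sym (ax4 y)) ⟩
    x ⇝ (𝟏 ⇝ y)        ≡⟨ cong (λ u → x ⇝ (u ⇝ y)) (sym x⇒y≡𝟏) ⟩
    x ⇝ (x ⋓₁ y)       ≡⟨ x⇝x⋓₁y≡𝟏 x y ⟩
    𝟏                  ∎

  x≤y⇒[y⇒x]⇝𝟏≡𝟏 : ∀ {x y} → x ≤ y → (y ⇒ x) ⇝ 𝟏 ≡ 𝟏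
  x≤y⇒[y⇒x]⇝𝟏≡𝟏 {x} {y} x≤y = begin
    (y ⇒ x) ⇝ 𝟏                    ≡⟨ sym (ax4 _) ⟩
    𝟏 ⇝ ((y ⇒ x) ⇝ 𝟏)              ≡⟨ sym (cong₂ (λ u v → u ⇝ ((y ⇒ x) ⇝ v)) x≤y (⇒-refl x)) ⟩
    (x ⇒ y) ⇝ ((y ⇒ x) ⇝ (x ⇒ x))  ≡⟨ ax1 x y x ⟩
    𝟏                              ∎

module PSemisimpleProperties {a : Level} (A : PseudoBCI a) (pss : IsPSemisimple A) where
  open PseudoBCI A hiding (Carrier)
  open PseudoBCIProperties A public

  ≤⇒≡ : ∀ {x y} → x ≤ y → x ≡ y
  ≤⇒≡ {x} {y} x≤y =
    ax5 x y x≤y (pss (y ⇒ x) (⇝≡𝟏⇒⇒≡𝟏 (x≤y⇒[y⇒x]⇝𝟏≡𝟏 x≤y)))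

  ⇝≡𝟏⇒≡ : ∀ {x y} → x ⇝ y ≡ 𝟏 → x ≡ y
  ⇝≡𝟏⇒≡ x⇝y≡𝟏 = ≤⇒≡ (⇝≡𝟏⇒⇒≡𝟏 x⇝y≡𝟏)

  ⋓₁-absorb : ∀ x y → x ⋓₁ y ≡ x
  ⋓₁-absorb x y = sym (⇝≡𝟏⇒≡ (x⇝x⋓₁y≡𝟏 x y))

  ⋓₂-absorb : ∀ x y → x ⋓₂ y ≡ x
  ⋓₂-absorb x y = sym (≤⇒≡ (x⇒x⋓₂y≡𝟏 x y))

module TypeIISymDerivationProperties
    {a : Level} (A : PseudoBCI a) (pss : IsPSemisimple A)
    (d : Carrier A → Carrier A) (isDer : IsTypeIISymDerivation A d) where
  open PseudoBCI A hiding (Carrier)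
  open PSemisimpleProperties A pss
  open ≡-Reasoning

  d-⇒ : ∀ x y → d (x ⇒ y) ≡ d x ⇒ y
  d-⇒ x y = trans (proj₁ isDer x y) (⋓₂-absorb _ _)

  d-⇝ : ∀ x y → d (x ⇝ y) ≡ d x ⇝ y
  d-⇝ x y = trans (proj₂ isDer x y) (⋓₁-absorb _ _)

  d≡d𝟏⇒ : ∀ z → d z ≡ d 𝟏 ⇒ z
  d≡d𝟏⇒ z = trans (cong d (sym (ax3 z))) (d-⇒ 𝟏 z)

  d≡d𝟏⇝ : ∀ z → d z ≡ d 𝟏 ⇝ z
  d≡d𝟏⇝ z = trans (cong d (sym (ax4 z))) (d-⇝ 𝟏 z)

  x⇒dx≡d𝟏 : ∀ x → x ⇒ d x ≡ d 𝟏
  x⇒dx≡d𝟏 x = sym (≤⇒≡ (begin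
    d 𝟏 ⇒ (x ⇒ d x)   ≡⟨ sym (d≡d𝟏⇒ (x ⇒ d x)) ⟩
    d (x ⇒ d x)       ≡⟨ d-⇒ x (d x) ⟩
    d x ⇒ d x         ≡⟨ ⇒-refl (d x) ⟩
    𝟏                 ∎))

  x⇝dx≡d𝟏 : ∀ x → x ⇝ d x ≡ d 𝟏
  x⇝dx≡d𝟏 x = sym (⇝≡𝟏⇒≡ (begin
    d 𝟏 ⇝ (x ⇝ d x)   ≡⟨ sym (d≡d𝟏⇝ (x ⇝ d x)) ⟩
    d (x ⇝ d x)       ≡⟨ d-⇝ x (d x) ⟩
    d x ⇝ d x         ≡⟨ ⇝-refl (d x) ⟩
    𝟏                 ∎))

  dy⇒y≡d𝟏 : ∀ y → d y ⇒ y ≡ d 𝟏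
  dy⇒y≡d𝟏 y = trans (cong (_⇒ y) (d≡d𝟏⇝ y)) (⋓₂-absorb (d 𝟏) y)

  dy⇝y≡d𝟏 : ∀ y → d y ⇝ y ≡ d 𝟏
  dy⇝y≡d𝟏 y = trans (cong (_⇝ y) (d≡d𝟏⇒ y)) (⋓₁-absorb (d 𝟏) y)

proposition5p11 : ∀ {a : Level} (A : PseudoBCI a) → IsPSemisimple A →
    (d : Carrier A → Carrier A) → IsTypeIISymDerivation A d →
    ∀ (x y : Carrier A) →
      ((d (PseudoBCI._⇒_ A x y) ≡ PseudoBCI._⇒_ A (d x) y) × (d (PseudoBCI._⇝_ A x y) ≡ PseudoBCI._⇝_ A (d x) y))
      × ((PseudoBCI._⇒_ A x (d x) ≡ PseudoBCI._⇒_ A y (d y)) × (PseudoBCI._⇝_ A x (d x) ≡ PseudoBCI._⇝_ A y (d y)))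
      × ((PseudoBCI._⇒_ A x (d x) ≡ PseudoBCI._⇒_ A (d y) y) × (PseudoBCI._⇝_ A x (d x) ≡ PseudoBCI._⇝_ A (d y) y))
proposition5p11 A pss d isDer x y =
    (d-⇒ x y , d-⇝ x y)
  , (trans (x⇒dx≡d𝟏 x) (sym (x⇒dx≡d𝟏 y)) , trans (x⇝dx≡d𝟏 x) (sym (x⇝dx≡d𝟏 y)))
  , (trans (x⇒dx≡d𝟏 x) (sym (dy⇒y≡d𝟏 y)) , trans (x⇝dx≡d𝟏 x) (sym (dy⇝y≡d𝟏 y)))
  where open TypeIISymDerivationProperties A pss d isDer
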